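{- For $m\ge1$ let $R_m^*=\{(x,y)\in\mathbb{Z}^2: 0\le x<2m,\ 0\le y<m,\ x\equiv y \pmod 2\}$, and for $(x,y)\in\mathbb{Z}^2$ and a positive integer $s$ let $$H(x,y,s)=\{(x,y),(x+2s,y),(x,y+2s),(x+2s,y+2s),(x-s,y+s),(x+3s,y+s)\}.$$ There exists a $2$-coloring of $R_{94}^*$ such that no set $H(x,y,s)\subseteq R_{94}^*$ (with $s$ a positive integer) is monochromatic. Consequently the Gallai number for regular hexagons on the triangular lattice (the least $m$ such that every $2$-coloring of $R_m^*$ makes some $H(x,y,s)\subseteq R_m^*$ monochromatic) is at least $95$.
   Context: The sets $H(x,y,s)$ are the vertex sets of regular hexagons of side $s$ in a coordinatization of the triangular lattice by points $(x,y)\in\mathbb{Z}^2$ with $x\equiv y\pmod 2$. -}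

module Defs where

open import Data.Bool using (Bool)
open import Data.Integer using (ℤ; +_; _+_; _-_; _*_; _≤_; _<_)
open import Data.Integer.Divisibility using (_∣_)
open import Data.Nat using (ℕ)
open import Data.Product using (_×_; _,_; ∃)
open import Data.List using (List; []; _∷_)
open import Data.List.Relation.Unary.All using (All)
open import Relation.Binary.PropositionalEquality using (_≡_)
open import Relation.Nullary using (¬_)

-- Points of the triangular lattice: (x , y) ∈ ℤ² (parity enforced in R*).
Point : Set
Point = ℤ × ℤ

InR* : ℕ → Point → Set
InR* m (x , y) =
  (+ 0 ≤ x) × (x < + 2 * + m) × (+ 0 ≤ y) × (y < + m) × (+ 2 ∣ (x - y))

H : ℤ → ℤ → ℤ → List Point
H x y s =
  (x , y) ∷ (x + + 2 * s , y) ∷ (x , y + + 2 * s) ∷ (x + + 2 * s , y + + 2 * s)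
  ∷ (x - s , y + s) ∷ (x + + 3 * s , y + s) ∷ []

HInR* : ℕ → ℤ → ℤ → ℤ → Set
HInR* m x y s = All (InR* m) (H x y s)

-- A 2-colouring (only its values on R*_m matter).
Colouring : Set
Colouring = Point → Bool

Monochromatic : Colouring → List Point → Set
Monochromatic c ps = ∃ λ (b : Bool) → All (λ p → c p ≡ b) ps

GoodColouring : ℕ → Colouring → Set
GoodColouring m c =
  ∀ (x y s : ℤ) → + 1 ≤ s → HInR* m x y s → ¬ Monochromatic c (H x y s)

-- R*₉₄ is coloured explicitly, row y being the binary expansion of a number
-- whose x-th bit is the colour of (x , y). A hexagon H(x,y,s) ⊆ R*ₘ with s ≥ 1
-- is fixed by s, y and u = x - s ranging over finite intervals, so goodness
-- reduces to a Boolean test over those intervals, which evaluates to true for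
-- this colouring. Since R*ₘ ⊆ R*₉₄ for m ≤ 94, the same colouring is good for every
-- smaller m.
module Submission where

open import Defs
open import Data.Nat using (ℕ; _≤_)
open import Data.Product using (_×_; ∃)

open import Data.Bool.Base using (Bool; true; false; T; not; _∨_)
open import Data.Bool.ListAction using (all)
open import Data.Bool.Properties using (T-∨; T-not-≡)
open import Data.Integer.Base as ℤ using (ℤ; +_; -[1+_]; +[1+_]; +≤+; ∣_∣)
import Data.Integer.Properties as ℤ
open import Data.List.Base using (List; []; _∷_; map; applyUpTo; upTo; drop; head)
open import Data.List.Membership.Propositional.Properties using (∈-applyUpTo⁺)
open import Data.List.Relation.Unary.All as All using (All; []; _∷_)
open import Data.List.Relation.Unary.All.Properties using (all⁺; all⁻; map⁺)
open import Data.Maybe.Base using (fromMaybe)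
open import Data.Nat.Base as ℕ using (suc; _+_; _*_; _∸_; _^_; _/_; _%_; _≡ᵇ_; _<_)
import Data.Nat.Divisibility as ℕ
import Data.Nat.Properties as ℕ
open import Algebra.Properties.CommutativeSemigroup ℕ.+-commutativeSemigroup using (xy∙z≈y∙xz)
open import Data.Product using (_,_; proj₁; proj₂)
open import Data.Sum.Base using (inj₁; inj₂)
open import Function.Base using (id; _∘_)
open import Function.Bundles using (Equivalence)
open import Relation.Binary.PropositionalEquality using (refl; subst; subst₂; sym)
open import Relation.Nullary.Decidable using (Dec; does; dec-true)
open import Relation.Nullary.Negation using (¬_)

all-applyUpTo⁻ : ∀ {A : Set} (p : A → Bool) (f : ℕ → A) {n i} →
                 T (all p (applyUpTo f n)) → i < n → T (p (f i))
all-applyUpTo⁻ p f t i<n = All.lookup (all⁺ p _ t) (∈-applyUpTo⁺ f i<n)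

T-not-guarded : ∀ {P : Set} (P? : Dec P) {b} → T (not (does P?) ∨ not b) → P → ¬ T b
T-not-guarded P? t p tb rewrite dec-true P? p = subst T (Equivalence.to T-not-≡ t) tb

m+n<o⇒m<o∸n : ∀ m {n o} → m + n < o → m < o ∸ n
m+n<o⇒m<o∸n m = ℕ.m+n≤o⇒m≤o∸n (suc m)

InR*-mono : ∀ {m n} → m ≤ n → ∀ {p} → InR* m p → InR* n p
InR*-mono {m} {n} m≤n {x , y} (0≤x , x<2m , 0≤y , y<m , x≡y) =
  0≤x , ℤ.<-≤-trans x<2m 2m≤2n , 0≤y , ℤ.<-≤-trans y<m (+≤+ m≤n) , x≡y
  where
  2m≤2n : + 2 ℤ.* + m ℤ.≤ + 2 ℤ.* + n
  2m≤2n = subst₂ ℤ._≤_ (ℤ.pos-* 2 m) (ℤ.pos-* 2 n) (+≤+ (ℕ.*-monoʳ-≤ 2 m≤n))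

GoodColouring-mono : ∀ {m n c} → m ≤ n → GoodColouring n c → GoodColouring m c
GoodColouring-mono m≤n good x y s 1≤s h = good x y s 1≤s (All.map (InR*-mono m≤n) h)

constantᵇ : List Bool → Bool
constantᵇ bs = all id bs ∨ all not bs

monochromatic⇒constantᵇ : ∀ {c ps} → Monochromatic c ps → T (constantᵇ (map c ps))
monochromatic⇒constantᵇ (true , cs) =
  Equivalence.from T-∨ (inj₁ (all⁻ id (map⁺ (All.map (λ e → subst T (sym e) _) cs))))
monochromatic⇒constantᵇ (false , cs) =
  Equivalence.from T-∨ (inj₂ (all⁻ not (map⁺ (All.map (λ e → subst (T ∘ not) (sym e) _) cs))))

hexagonOKᵇ : Colouring → ℤ → ℤ → ℤ → Bool
hexagonOKᵇ c x y s = not (does (2 ℕ.∣? ∣ x ℤ.- y ∣)) ∨ not (constantᵇ (map c (H x y s)))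

-- H(s + u, y, s) ⊆ R*ₘ iff u + 4s < 2m, y + 2s < m and s + u ≡ y (mod 2).
noMonochromaticHexagonᵇ : ℕ → Colouring → Bool
noMonochromaticHexagonᵇ m c =
  all (λ s → all (λ y → all (λ u → hexagonOKᵇ c (+ (s + u)) (+ y) (+ s))
                                (upTo (2 * m ∸ 4 * s)))
                 (upTo (m ∸ 2 * s)))
      (applyUpTo suc m)

HInR*⇒bounds : ∀ {m s u y} → HInR* m (+ (suc s + u)) (+ y) +[1+ s ] →
               u + 4 * suc s < 2 * m × y + 2 * suc s < m
HInR*⇒bounds {m} {s} {u} (_ ∷ _ ∷ (_ , _ , _ , y₃<m , _) ∷ _ ∷ _ ∷ (_ , x₆<2m , _) ∷ []) =
  subst (_< 2 * m) (xy∙z≈y∙xz (suc s) u (3 * suc s))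
        (ℤ.drop‿+<+ (subst (_ ℤ.<_) (sym (ℤ.pos-* 2 m)) x₆<2m)) ,
  ℤ.drop‿+<+ y₃<m

noMonochromaticHexagonᵇ-sound : ∀ m c → T (noMonochromaticHexagonᵇ m c) → GoodColouring m c
noMonochromaticHexagonᵇ-sound m c ok (+ x) (+ y) +[1+ s ] _
  h@((_ , _ , _ , _ , x≡y) ∷ _ ∷ _ ∷ _ ∷ (0≤x₅ , _) ∷ _) mono
  with u , refl ← ℕ.m≤n⇒∃[o]m+o≡n (ℤ.drop‿+≤+ (ℤ.0≤i-j⇒j≤i {+ x} {+[1+ s ]} 0≤x₅))
  = T-not-guarded (2 ℕ.∣? _) hexagon-checked x≡y (monochromatic⇒constantᵇ mono)
  where
  u-bound : u + 4 * suc s < 2 * m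
  u-bound = proj₁ (HInR*⇒bounds h)

  y-bound : y + 2 * suc s < m
  y-bound = proj₂ (HInR*⇒bounds h)

  s<m : s < m
  s<m = ℕ.m+n≤o⇒m≤o (suc s) (ℕ.m+n≤o⇒n≤o y (ℕ.<⇒≤ y-bound))

  hexagon-checked : T (hexagonOKᵇ c (+ (suc s + u)) (+ y) (+ suc s))
  hexagon-checked =
    all-applyUpTo⁻ _ id
      (all-applyUpTo⁻ _ id (all-applyUpTo⁻ _ suc ok s<m) (m+n<o⇒m<o∸n y y-bound))
      (m+n<o⇒m<o∸n u u-bound)
noMonochromaticHexagonᵇ-sound m c ok _ _ (+ 0) (+≤+ ()) _ _
noMonochromaticHexagonᵇ-sound m c ok -[1+ _ ] _ _ _ ((() , _) ∷ _) _
noMonochromaticHexagonᵇ-sound m c ok (+ _) -[1+ _ ] _ _ ((_ , _ , () , _) ∷ _) _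

testBit : ℕ → ℕ → Bool
testBit n i = (n / 2 ^ i) {{ℕ.m^n≢0 2 i}} % 2 ≡ᵇ 1

rows : List ℕ
rows =
  98199542061467561888182760115943785209757553248395412560 ∷
  212506045396079362793644011197276307378698794342344075818 ∷
  106155721376393845630390460209692804593162772145839816977 ∷
  15325751393484476292654684875624054930534686504813502600 ∷
  104209821128220712484941138036769734541550843957647246416 ∷
  212505097432303379259707705328972381312550981122423655040 ∷
  106221588248048516983818915011904665855055498585809421572 ∷
  49854232569691033897321060293107032159545946343460733482 ∷
  7765864695625929357975019355444169587662868766272000081 ∷
  1017688406590696237865738319131574528530242133532780552 ∷
  122725737612839535180630725456327533032017469993062252560 ∷
  208659829032306700727802677515126809761922358236229438090 ∷
  104622869624832517897496487857478460115790873121017304384 ∷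
  248315211694549089919747841720463548518718654236565446688 ∷
  480496547879132978282215669286820026873327521730938128 ∷
  207509895041589159598396125414243012351058786894086304 ∷
  104718650110961975946007628677500090173085679773858206037 ∷
  261338441814907548933641731858205580936639987613627320458 ∷
  6513597234575605116740087560131009154319767621321707777 ∷
  208482252755325460466606561602024363935360961019742562952 ∷
  103364823300566697639986946518487410517389794604224772 ∷
  52108076175754374752170221307875011149840689729163141760 ∷
  129238562687829845527622631260255966256609938979210724436 ∷
  4038529489711223295898616995442678326887652399614404608 ∷
  32567525581370537637617084776502341542169473527163392336 ∷
  52117815574905548228748888596621091494578930554719701538 ∷
  6538951341157141671465861721956016534194368113829826560 ∷
  50060526985463102127349492928862436839465923056467872418 ∷
  26437046234745631967378638332905874847609009151986910228 ∷
  12455501614829022247087581580062579867470532772920066730 ∷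
  124134011388012052231052067279402486736038908262343790913 ∷
  261497953027185499715192187933084631815250621174651202176 ∷
  30775652601200890601439414749781975427634245988685791253 ∷
  196411839332845731120310195756453225217395896801929724450 ∷
  105843965904934733502075938213297041885826019949909656656 ∷
  200230358190865146220220797448652076611578027619203557376 ∷
  26467379957062992434273366919251797764223017033334277136 ∷
  52871892144711873791545047345854940255537704178511512106 ∷
  6161439897664609822312106776682884250731031821078827344 ∷
  3080006746703671813496843358541848050152376564514957314 ∷
  26563139024110700609390367347891714077034879126262321412 ∷
  257462995279239453965515888024964690083583649989408628898 ∷
  24903527619874385666598978582543421411860821169569599812 ∷
  199463885392663250278159555349636204843461785022024395392 ∷
  104714417625038001913297363989914693181454678176447090964 ∷
  200194451114444508472054299106641136644317172845871399592 ∷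
  486886488135744973679039368051897460720793866344858704 ∷
  15517464405086526462405912726346751674558011453257452032 ∷
  32571611940310531745373928916975921256620961279513740609 ∷
  62126883461770494618880235368689608813710487930228320802 ∷
  2035820721134323154587458116287204264336102194029794369 ∷
  52921994610015230561775906527306911617664233899387519496 ∷
  105772522870390327765304308726115418492353591289588285461 ∷
  49857795708009490841295387537697982107102187599094786696 ∷
  98201336764336068434680822990561833945242929317925699648 ∷
  16142286509402308487573907623124798602952043269453946912 ∷
  129113148789237419192448528237804820304084256795891335492 ∷
  12463735840695416161507600700483616604265583479043564168 ∷
  121692048041878683417750102852843568964242556501103937 ∷
  15529437208666479790714601071405541576862083740713650338 ∷
  104592921623429943965779353083945104928225285740640359425 ∷
  257474220528140668010312036893569256657034211551961196584 ∷
  2042830384130916915701462083067267279564370336791479637 ∷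
  200051478977443544623988511208457625631038299105506492554 ∷
  130651355882428338143020737232123319404206932244032717840 ∷
  61503406086865011043145556824245415109677872891019002504 ∷
  106229071135005717321322567946446378220211335459028161796 ∷
  63806250614950197772164473773339765817766234318053920 ∷
  104689005130195096378832965398066601391367026053664227396 ∷
  16139141360566567481166553842933763398721534191897019048 ∷
  121322204359001725387304635409908146864066576817407296 ∷
  64560175523102186246400762143082187784567716336847858218 ∷
  1947521180880460203624262403199131639134236069436915780 ∷
  49854981395232965423351162418545539038701045911889545216 ∷
  26561383462634114311643228287550116539394033471157522449 ∷
  196989515635610001787534247983288456439516484446794023456 ∷
  124228295874075674028958644576644667256583054003078697301 ∷
  261342311825437528589958353086191635853780476460816968226 ∷
  7664465718092298772155841173280209559842701448278524928 ∷
  13229746710844547062462071154082040340124239284374997504 ∷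
  6154420417722747011404637013253728200759562625844580421 ∷
  4070879132670760821678597587637527581464749913948594722 ∷
  124617031827083144682990677105630706193595509389854512145 ∷
  12272931697176371823809405620194986781985378162876917770 ∷
  24647611739728853032701082111634613059483879931279070464 ∷
  211533070196486356620362590820043382573898268957726640288 ∷
  129120263270855592729689623981374195613133733680353644804 ∷
  50000906453590987219062039468803144886793863963351714466 ∷
  2012902941322352640989388510934590335666761680728184145 ∷
  15516754118335401434200312490264319271904682959819505698 ∷
  26083970821742172276608132468612490169964047984205496400 ∷
  209197675392631906422452250367275512880120069233033388706 ∷
  129238467787387421908502605701164733384169522428416185681 ∷
  15531731586883346516503441418541114251560625249135372290 ∷
  []

row : ℕ → ℕ
row y = fromMaybe 0 (head (drop y rows))

colouring : Colouring
colouring (+ x , + y) = testBit (row y) x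
colouring _           = false

mainTheorem10 : (∃ λ (c : Colouring) → GoodColouring 94 c)
    × (∀ (m : ℕ) → 1 ≤ m → m ≤ 94 → ∃ λ (c : Colouring) → GoodColouring m c)
mainTheorem10 =
  (colouring , colouring-good) , λ m _ m≤94 → colouring , GoodColouring-mono m≤94 colouring-good
  where
  -- The `_` is found by evaluating the checker on all 134 044 hexagons.
  colouring-good : GoodColouring 94 colouring
  colouring-good = noMonochromaticHexagonᵇ-sound 94 colouring _
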